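{- Let $\zeta$ be a partial assignment with support $I\subseteq\{0,\dots,K-1\}$, where $|I|\le\sqrt{K}$. If $\zeta$ is not a certificate for $\mathrm{LSBSimon}$, then $K^{|I|}\Pr_y[y \text{ extends } \zeta] \le \mathrm{poly}(K)$, where $y$ is sampled uniformly at random from all legal inputs of $\mathrm{LSBSimon}$.
   Context: Let $k$ be an integer and $K=2^k$; indices in $\{0,\dots,K-1\}$ are identified with $k$-bit strings and $\oplus$ is bitwise XOR. $\mathrm{Simon}$ is the partial function on strings $y=y_0y_1\dots y_{K-1}$ with $y_i\in\{0,\dots,K-1\}$, defined (legal) on those $y$ for which there is some $a$ with: for all $i\ne j$, $y_i=y_j \iff i\oplus j=a$; its value is $\mathrm{Simon}(y)=a$. $\mathrm{LSBSimon}(y)=\mathrm{Simon}(y)\bmod 2$, with the same legal inputs. A partial assignment with support $I$ is a vector $\zeta=(\zeta_i)_{i\in I}$ with $\zeta_i\in\{0,\dots,K-1\}$; a string $y$ extends $\zeta$ if $y_i=\zeta_i$ for all $i\in I$. $\zeta$ is a certificate for a partial function $f$ if $f(y)$ takes the same value for every legal input $y$ extending $\zeta$. $\mathrm{poly}(K)$ denotes a bound of the form $\mathcal{O}(K^{\mathcal{O}(1)})$ with absolute constants. -}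

module Defs where

open import Data.Nat using (ℕ; zero; suc; _+_; _*_; _^_; _≤_)
open import Data.Nat.DivMod using (_/_; _%_)
import Data.Nat.Properties as ℕP
open import Data.Fin using (Fin; toℕ)
import Data.Fin.Properties as FinP
open import Data.Vec using (Vec; []; _∷_; lookup)
open import Data.List using (List; [_]; map; concatMap; allFin; filter; length)
open import Data.Maybe using (Maybe; just; nothing)
open import Data.Product using (Σ; ∃; ∃-syntax; _×_; _,_)
open import Data.Unit using (⊤; tt)
open import Relation.Nullary using (Dec; yes; no; ¬_; ¬?)
open import Relation.Nullary.Decidable using (_×-dec_; _→-dec_)
open import Relation.Binary.PropositionalEquality using (_≡_; _≢_)

-- Bitwise XOR of the k low-order bits of two naturals
-- (bit 0 = least significant).  For m, n < 2^k this is the usual XOR.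
xorBits : ℕ → ℕ → ℕ → ℕ
xorBits zero    m n = 0
xorBits (suc k) m n = ((m % 2 + n % 2) % 2) + 2 * xorBits k (m / 2) (n / 2)

Kof : ℕ → ℕ
Kof k = 2 ^ k

Sym : ℕ → Set
Sym k = Fin (Kof k)

xor : (k : ℕ) → Sym k → Sym k → ℕ
xor k i j = xorBits k (toℕ i) (toℕ j)

Input : ℕ → Set
Input k = Vec (Sym k) (Kof k)

IsSimon : (k : ℕ) → Input k → Sym k → Set
IsSimon k y a = ∀ (i j : Sym k) → i ≢ j →
  ((lookup y i ≡ lookup y j → xor k i j ≡ toℕ a) × (xor k i j ≡ toℕ a → lookup y i ≡ lookup y j))

-- legal inputs of Simon (and of LSBSimon)
Legal : (k : ℕ) → Input k → Set
Legal k y = Σ (Sym k) (IsSimon k y)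

-- LSBSimon(y) = Simon(y) mod 2
LSB : (k : ℕ) → Sym k → ℕ
LSB k a = toℕ a % 2

-- partial assignments: ζ_i = just v for i ∈ I, nothing for i ∉ I
PartialAssignment : ℕ → Set
PartialAssignment k = Vec (Maybe (Sym k)) (Kof k)

supportSize : {A : Set} {n : ℕ} → Vec (Maybe A) n → ℕ
supportSize []              = 0
supportSize (nothing ∷ ζ)   = supportSize ζ
supportSize (just _ ∷ ζ)    = suc (supportSize ζ)

Agrees : (k : ℕ) → Maybe (Sym k) → Sym k → Set
Agrees k nothing  _ = ⊤
Agrees k (just v) w = w ≡ v

Extends : (k : ℕ) → Input k → PartialAssignment k → Set
Extends k y ζ = ∀ (i : Sym k) → Agrees k (lookup ζ i) (lookup y i)

IsCertificate : (k : ℕ) → PartialAssignment k → Set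
IsCertificate k ζ = ∀ (y y' : Input k) (a a' : Sym k) →
  Extends k y ζ → Extends k y' ζ → IsSimon k y a → IsSimon k y' a' → LSB k a ≡ LSB k a'

agrees? : (k : ℕ) (m : Maybe (Sym k)) (w : Sym k) → Dec (Agrees k m w)
agrees? k nothing  w = yes tt
agrees? k (just v) w = w FinP.≟ v

extends? : (k : ℕ) (y : Input k) (ζ : PartialAssignment k) → Dec (Extends k y ζ)
extends? k y ζ = FinP.all? {P = λ i → Agrees k (lookup ζ i) (lookup y i)}
  (λ i → agrees? k (lookup ζ i) (lookup y i))

isSimon? : (k : ℕ) (y : Input k) (a : Sym k) → Dec (IsSimon k y a)
isSimon? k y a = FinP.all? {P = λ i → ∀ j → i ≢ j →
    ((lookup y i ≡ lookup y j → xor k i j ≡ toℕ a) × (xor k i j ≡ toℕ a → lookup y i ≡ lookup y j))}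
  λ i → FinP.all? {P = λ j → i ≢ j →
    ((lookup y i ≡ lookup y j → xor k i j ≡ toℕ a) × (xor k i j ≡ toℕ a → lookup y i ≡ lookup y j))}
  λ j → ¬? (i FinP.≟ j) →-dec
    (((lookup y i FinP.≟ lookup y j) →-dec (xor k i j ℕP.≟ toℕ a)) ×-dec
     ((xor k i j ℕP.≟ toℕ a) →-dec (lookup y i FinP.≟ lookup y j)))

legal? : (k : ℕ) (y : Input k) → Dec (Legal k y)
legal? k y = FinP.any? {P = IsSimon k y} (isSimon? k y)

legalExt? : (k : ℕ) (ζ : PartialAssignment k) (y : Input k) → Dec (Legal k y × Extends k y ζ)
legalExt? k ζ y = legal? k y ×-dec extends? k y ζ

allStrings : (n m : ℕ) → List (Vec (Fin m) n)
allStrings zero    m = [ [] ]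
allStrings (suc n) m = concatMap (λ x → map (x ∷_) (allStrings n m)) (allFin m)

allInputs : (k : ℕ) → List (Input k)
allInputs k = allStrings (Kof k) (Kof k)

numLegal : (k : ℕ) → ℕ
numLegal k = length (filter (legal? k) (allInputs k))

numLegalExt : (k : ℕ) → PartialAssignment k → ℕ
numLegalExt k ζ = length (filter (legalExt? k ζ) (allInputs k))

-- Split the legal inputs extending ζ according to their Simon value a.
-- For a = 0 the legal inputs are exactly the injective strings, and at most (K − s)! of
-- them extend ζ (s = |I|); as s² ≤ K, the Weierstrass product inequality gives
-- K^s ≤ 2 K (K − 1) ⋯ (K − s + 1), so K^s times this count is at most 2 K!.
-- For a ≠ 0 forget ζ: the L = K/2 positions i with i < i ⊕ a carry distinct values and
-- every other position copies its smaller partner, so there are at most K!/(K − L)! such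
-- inputs, while K^s ≤ K^6 (K − L)! because s ≤ √K.
-- Summing over the K values of a and using that all K! injective strings are legal
-- gives K^s · numLegalExt ≤ 2 K^7 · numLegal.
-- Both upper counts are instances of one estimate: strings of length n over an m-letter
-- alphabet whose free coordinates take distinct values outside a set B, and whose other
-- coordinates are determined by the preceding ones, number at most
-- (m − |B|)(m − |B| − 1) ⋯ (one factor per free coordinate).

module Submission where

open import Defs

open import Data.Nat using (ℕ; zero; suc; _+_; _*_; _∸_; _^_; _!; _≤_; _<_; _≟_; _≤?_; _<?_; z≤n; s≤s; NonZero)
open import Data.Nat.Tactic.RingSolver using (solve-∀)
open import Data.Nat.Divisibility using (∣⇒≤; m≤n⇒m!∣n!; m∣m*n)
open import Data.Nat.DivMod using (_%_; _/_; m%n<n; [m+kn]%n≡m%n; m<n⇒m%n≡m; +-distrib-/-∣ʳ; m<n⇒m/n≡0; m*n/n≡m; m*n%n≡0; m≡m%n+[m/n]*n; m<n*o⇒m/o<n)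
open import Data.Nat.Properties
open import Data.Nat.ListAction using (sum)
open import Data.Fin using (Fin; zero; suc; toℕ; fromℕ<)
import Data.Fin.Properties as Fin
open import Data.Vec using (Vec; []; _∷_; lookup; toList)
open import Data.Maybe using (Maybe; just; nothing)
import Data.Maybe.Properties as Maybe
open import Data.List using (List; []; _∷_; _++_; [_]; length; map; filter; concat; catMaybes; allFin; tabulate)
open import Data.List.Properties using (filter-++; filter-none; length-++; length-filter; length-tabulate; map-∘; map-cong; map-tabulate; length-map)
open import Data.List.Membership.Propositional using (_∈_; _∉_; lose)
open import Data.List.Membership.Propositional.Properties using (∈-map⁻; ∈-∃++; ∈-++⁻; ∈-++⁺ˡ; ∈-++⁺ʳ; ∈-filter⁺; ∈-filter⁻; ∈-allFin)
import Data.List.Membership.DecPropositional as DecMembership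
open import Data.List.Relation.Binary.Subset.Propositional using (_⊆_)
open import Data.List.Relation.Unary.All as All using (All)
open import Data.List.Relation.Unary.Any using (here; there; any?; toSum; satisfied)
open import Data.List.Relation.Unary.All.Properties using (¬Any⇒All¬)
open import Data.List.Relation.Unary.AllPairs using ([]; _∷_)
open import Data.List.Relation.Unary.Unique.Propositional using (Unique)
import Data.List.Relation.Unary.Unique.Propositional.Properties as Unique
open import Data.List.Relation.Unary.Unique.DecPropositional using (unique?)
open import Data.Product using (_×_; _,_; proj₁; proj₂; ∃-syntax)
open import Data.Unit using (⊤; tt)
open import Data.Sum using (_⊎_; inj₁; inj₂)
open import Function using (_∘_; id)
open import Relation.Nullary using (yes; no; ¬_; contradiction)
open import Relation.Nullary.Decidable using (_⊎-dec_; _×-dec_)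
open import Relation.Unary using (Decidable; ∁)
open import Relation.Unary.Properties using (∁?)
open import Relation.Binary.PropositionalEquality using (_≡_; _≢_; refl; sym; trans; cong; cong₂; subst; module ≡-Reasoning)

fall : ℕ → ℕ → ℕ
fall m zero    = 1
fall m (suc t) = m * fall (m ∸ 1) t

fall-∸-suc : ∀ m b t → (m ∸ b) * fall (m ∸ suc b) t ≡ fall (m ∸ b) (suc t)
fall-∸-suc m b t = cong (λ r → (m ∸ b) * fall r t) (trans (cong (m ∸_) (+-comm 1 b)) (sym (∸-+-assoc m b 1)))

fall-suc : ∀ m t → fall m (suc t) ≡ fall m t * (m ∸ t)
fall-suc m zero    = trans (*-identityʳ m) (sym (*-identityˡ m))
fall-suc m (suc t) = begin
  m * fall (m ∸ 1) (suc t)             ≡⟨ cong (m *_) (fall-suc (m ∸ 1) t) ⟩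
  m * (fall (m ∸ 1) t * (m ∸ 1 ∸ t))   ≡⟨ *-assoc m _ _ ⟨
  fall m (suc t) * (m ∸ 1 ∸ t)         ≡⟨ cong (fall m (suc t) *_) (∸-+-assoc m 1 t) ⟩
  fall m (suc t) * (m ∸ suc t)         ∎
  where open ≡-Reasoning

fall-diag : ∀ m → fall m m ≡ m !
fall-diag zero    = refl
fall-diag (suc m) = cong (suc m *_) (fall-diag m)

fall≤pow : ∀ m t → fall m t ≤ m ^ t
fall≤pow m zero    = ≤-refl
fall≤pow m (suc t) = *-monoʳ-≤ m (≤-trans (fall≤pow (m ∸ 1) t) (^-monoˡ-≤ t (m∸n≤m m 1)))

pow≤fall : ∀ {m n} t → t + n ≤ m → n ^ t ≤ fall m t
pow≤fall         zero    _     = ≤-refl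
pow≤fall {m} {n} (suc t) t+n<m = *-mono-≤ (≤-trans (m≤n+m n (suc t)) t+n<m) (pow≤fall t (∸-monoˡ-≤ 1 t+n<m))

fall≤! : ∀ m t → fall m t ≤ m !
fall≤! m       zero    = 1≤n! m
fall≤! zero    (suc t) = z≤n
fall≤! (suc m) (suc t) = *-monoʳ-≤ (suc m) (fall≤! m t)

fall*!≤! : ∀ m t → fall m t * (m ∸ t) ! ≤ m !
fall*!≤! m       zero    = ≤-reflexive (*-identityˡ (m !))
fall*!≤! zero    (suc t) = z≤n
fall*!≤! (suc m) (suc t) = ≤-trans (≤-reflexive (*-assoc (suc m) (fall m t) _)) (*-monoʳ-≤ (suc m) (fall*!≤! m t))

K*fall≤fall-suc : ∀ K s → K * fall K s ≤ fall K (suc s) + s * fall K s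
K*fall≤fall-suc K s = begin
  K * fall K s                          ≤⟨ *-monoˡ-≤ (fall K s) (m≤n+m∸n K s) ⟩
  (s + (K ∸ s)) * fall K s              ≡⟨ *-distribʳ-+ (fall K s) s (K ∸ s) ⟩
  s * fall K s + (K ∸ s) * fall K s     ≡⟨ +-comm (s * fall K s) _ ⟩
  (K ∸ s) * fall K s + s * fall K s     ≡⟨ cong (_+ s * fall K s) (trans (*-comm (K ∸ s) (fall K s)) (sym (fall-suc K s))) ⟩
  fall K (suc s) + s * fall K s         ∎
  where open ≤-Reasoning

-- The Weierstrass product inequality ∏_{i<s} (1 − i/K) ≥ 1 − s²/(2K), cleared of denominators.
weierstrass : ∀ K s → 2 * K * K ^ s ≤ 2 * K * fall K s + s * s * K ^ s
weierstrass K zero    = m≤m+n (2 * K * 1) 0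
weierstrass K (suc s) = begin
  2 * K * K ^ suc s
    ≡⟨ shift-K K (K ^ s) ⟩
  K * (2 * K * K ^ s)
    ≤⟨ *-monoʳ-≤ K (weierstrass K s) ⟩
  K * (2 * K * f + s * s * K ^ s)
    ≡⟨ distribute K s f (K ^ s) ⟩
  2 * K * (K * f) + s * s * K ^ suc s
    ≤⟨ +-monoˡ-≤ _ (*-monoʳ-≤ (2 * K) (K*fall≤fall-suc K s)) ⟩
  2 * K * (fall K (suc s) + s * f) + s * s * K ^ suc s
    ≤⟨ +-monoˡ-≤ _ (*-monoʳ-≤ (2 * K) (+-monoʳ-≤ _ (*-monoʳ-≤ s (fall≤pow K s)))) ⟩
  2 * K * (fall K (suc s) + s * K ^ s) + s * s * K ^ suc s
    ≡⟨ collect K s (fall K (suc s)) (K ^ s) ⟩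
  2 * K * fall K (suc s) + (2 * s + s * s) * K ^ suc s
    ≤⟨ +-monoʳ-≤ _ (*-monoˡ-≤ (K ^ suc s) (≤-trans (m≤n+m _ 1) (≤-reflexive (square-suc s)))) ⟩
  2 * K * fall K (suc s) + suc s * suc s * K ^ suc s ∎
  where
  open ≤-Reasoning
  f : ℕ
  f = fall K s
  shift-K : ∀ K x → 2 * K * (K * x) ≡ K * (2 * K * x)
  shift-K = solve-∀
  distribute : ∀ K s f x → K * (2 * K * f + s * s * x) ≡ 2 * K * (K * f) + s * s * (K * x)
  distribute = solve-∀
  collect : ∀ K s g x → 2 * K * (g + s * x) + s * s * (K * x) ≡ 2 * K * g + (2 * s + s * s) * (K * x)
  collect = solve-∀
  square-suc : ∀ s → 1 + (2 * s + s * s) ≡ suc s * suc s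
  square-suc = solve-∀

pow≤2*fall : ∀ {K s} .{{_ : NonZero K}} → s * s ≤ K → K ^ s ≤ 2 * fall K s
pow≤2*fall {K} {s} s²≤K = *-cancelˡ-≤ K (+-cancelʳ-≤ (K * K ^ s) _ _ (begin
  K * K ^ s + K * K ^ s             ≡⟨ double K (K ^ s) ⟩
  2 * K * K ^ s                     ≤⟨ weierstrass K s ⟩
  2 * K * fall K s + s * s * K ^ s  ≤⟨ +-monoʳ-≤ _ (*-monoˡ-≤ (K ^ s) s²≤K) ⟩
  2 * K * fall K s + K * K ^ s      ≡⟨ cong (_+ K * K ^ s) (swap K (fall K s)) ⟩
  K * (2 * fall K s) + K * K ^ s    ∎))
  where
  open ≤-Reasoning
  double : ∀ K x → K * x + K * x ≡ 2 * K * x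
  double = solve-∀
  swap : ∀ K x → 2 * K * x ≡ K * (2 * x)
  swap = solve-∀

pow≤[n+n]! : ∀ n → n ^ n ≤ (n + n) !
pow≤[n+n]! n = ≤-trans (pow≤fall n ≤-refl) (fall≤! (n + n) n)

m*m≤n*n⇒m≤n : ∀ {m n} → m * m ≤ n * n → m ≤ n
m*m≤n*n⇒m≤n {m} {n} m²≤n² with m ≤? n
... | yes m≤n = m≤n
... | no  m≰n = contradiction m²≤n² (<⇒≱ (*-mono-< (≰⇒> m≰n) (≰⇒> m≰n)))

pow≤[K∸L]! : ∀ {K q s L} → K ≡ 16 * q → 4 ≤ q → s * s ≤ K → 2 * L ≤ K → K ^ s ≤ (K ∸ L) !
pow≤[K∸L]! {q = q@(suc _)} {s} {L} refl 4≤q s²≤K 2L≤K = begin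
  (16 * q) ^ s             ≤⟨ ^-monoʳ-≤ (16 * q) s≤2q ⟩
  (16 * q) ^ (2 * q)       ≡⟨ ^-*-assoc (16 * q) 2 q ⟨
  ((16 * q) ^ 2) ^ q       ≤⟨ ^-monoˡ-≤ q square≤fourth ⟩
  ((4 * q) ^ 4) ^ q        ≡⟨ ^-*-assoc (4 * q) 4 q ⟩
  (4 * q) ^ (4 * q)        ≤⟨ pow≤[n+n]! (4 * q) ⟩
  (4 * q + 4 * q) !        ≤⟨ ∣⇒≤ {{(16 * q ∸ L) !≢0}} (m≤n⇒m!∣n! 8q≤K∸L) ⟩
  (16 * q ∸ L) !           ∎
  where
  open ≤-Reasoning
  s≤2q : s ≤ 2 * q
  s≤2q = m*m≤n*n⇒m≤n (begin
    s * s           ≤⟨ s²≤K ⟩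
    16 * q          ≡⟨ *-assoc 4 4 q ⟩
    4 * (4 * q)     ≤⟨ *-monoʳ-≤ 4 (*-monoˡ-≤ q 4≤q) ⟩
    4 * (q * q)     ≡⟨ square q ⟩
    2 * q * (2 * q) ∎)
    where
    square : ∀ q → 4 * (q * q) ≡ 2 * q * (2 * q)
    square = solve-∀
  square≤fourth : (16 * q) ^ 2 ≤ (4 * q) ^ 4
  square≤fourth = ≤-trans (m≤m*n ((16 * q) ^ 2) (q * q)) (≤-reflexive (powers q))
    where
    powers : ∀ q → 16 * q * (16 * q * 1) * (q * q) ≡ 4 * q * (4 * q * (4 * q * (4 * q * 1)))
    powers = solve-∀
  8q≤K∸L : 4 * q + 4 * q ≤ 16 * q ∸ L
  8q≤K∸L = begin
    4 * q + 4 * q                  ≡⟨ m+n∸n≡m (4 * q + 4 * q) (8 * q) ⟨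
    4 * q + 4 * q + 8 * q ∸ 8 * q  ≡⟨ cong (_∸ 8 * q) (sixteen q) ⟩
    16 * q ∸ 8 * q                 ≤⟨ ∸-monoʳ-≤ (16 * q) L≤8q ⟩
    16 * q ∸ L                     ∎
    where
    L≤8q : L ≤ 8 * q
    L≤8q = *-cancelˡ-≤ 2 (≤-trans 2L≤K (≤-reflexive (*-assoc 2 8 q)))
    sixteen : ∀ q → 4 * q + 4 * q + 8 * q ≡ 16 * q
    sixteen = solve-∀

pow≤pow⁶*[K∸L]! : ∀ k {s L} → s * s ≤ 2 ^ k → 2 * L ≤ 2 ^ k → (2 ^ k) ^ s ≤ (2 ^ k) ^ 6 * (2 ^ k ∸ L) !
pow≤pow⁶*[K∸L]! k {s} {L} s²≤K 2L≤K with k ≤? 5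
... | yes k≤5 = ≤-trans (^-monoʳ-≤ (2 ^ k) s≤6)
                      (m≤m*n ((2 ^ k) ^ 6) ((2 ^ k ∸ L) !) {{(2 ^ k ∸ L) !≢0}})
  where
  instance
    K≢0 : NonZero (2 ^ k)
    K≢0 = m^n≢0 2 k
  s≤6 : s ≤ 6
  s≤6 = m*m≤n*n⇒m≤n (≤-trans s²≤K (≤-trans (^-monoʳ-≤ 2 k≤5) (m≤m+n 32 4)))
... | no  k≰5 = ≤-trans (pow≤[K∸L]! {s = s} {L} K≡16q (^-monoʳ-≤ 2 2≤k∸4) s²≤K 2L≤K)
                      (m≤n*m ((2 ^ k ∸ L) !) ((2 ^ k) ^ 6))
  where
  instance
    K≢0 : NonZero (2 ^ k)
    K≢0 = m^n≢0 2 k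
    K⁶≢0 : NonZero ((2 ^ k) ^ 6)
    K⁶≢0 = m^n≢0 (2 ^ k) 6
  4≤k : 4 ≤ k
  4≤k = ≤-trans (m≤m+n 4 2) (≰⇒> k≰5)
  2≤k∸4 : 2 ≤ k ∸ 4
  2≤k∸4 = ∸-monoˡ-≤ 4 (≰⇒> k≰5)
  K≡16q : 2 ^ k ≡ 16 * 2 ^ (k ∸ 4)
  K≡16q = trans (cong (2 ^_) (sym (m+[n∸m]≡n 4≤k))) (^-distribˡ-+-* 2 4 (k ∸ 4))

count : {A : Set} {P : A → Set} → Decidable P → List A → ℕ
count P? xs = length (filter P? xs)

module _ {A : Set} {P : A → Set} (P? : Decidable P) where

  count-++ : ∀ xs ys → count P? (xs ++ ys) ≡ count P? xs + count P? ys
  count-++ xs ys = trans (cong length (filter-++ P? xs ys)) (length-++ (filter P? xs))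

  count-concat : ∀ xss → count P? (concat xss) ≡ sum (map (count P?) xss)
  count-concat []         = refl
  count-concat (xs ∷ xss) = trans (count-++ xs (concat xss)) (cong (count P? xs +_) (count-concat xss))

  count-none : ∀ {xs} → All (∁ P) xs → count P? xs ≡ 0
  count-none ¬Ps = cong length (filter-none P? ¬Ps)

  count-+-count-∁ : ∀ xs → count P? xs + count (∁? P?) xs ≡ length xs
  count-+-count-∁ []       = refl
  count-+-count-∁ (x ∷ xs) with P? x
  ... | yes _ = cong suc (count-+-count-∁ xs)
  ... | no  _ = trans (+-suc _ _) (cong suc (count-+-count-∁ xs))

  count-mono : {Q : A → Set} (Q? : Decidable Q) → (∀ {x} → P x → Q x) → ∀ xs → count P? xs ≤ count Q? xs
  count-mono Q? P⇒Q []       = z≤n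
  count-mono Q? P⇒Q (x ∷ xs) with P? x | Q? x
  ... | yes _  | yes _  = s≤s (count-mono Q? P⇒Q xs)
  ... | yes Px | no ¬Qx = contradiction (P⇒Q Px) ¬Qx
  ... | no _   | yes _  = m≤n⇒m≤1+n (count-mono Q? P⇒Q xs)
  ... | no _   | no _   = count-mono Q? P⇒Q xs

  count-⊎ : {Q : A → Set} (Q? : Decidable Q) → ∀ xs → count (λ x → P? x ⊎-dec Q? x) xs ≤ count P? xs + count Q? xs
  count-⊎ Q? []       = z≤n
  count-⊎ Q? (x ∷ xs) with ih ← count-⊎ Q? xs | P? x | Q? x
  ... | yes _ | yes _ = s≤s (≤-trans ih (+-monoʳ-≤ (count P? xs) (n≤1+n _)))
  ... | yes _ | no  _ = s≤s ih
  ... | no  _ | yes _ = ≤-trans (s≤s ih) (≤-reflexive (sym (+-suc _ _)))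
  ... | no  _ | no  _ = ih

count-map : {A B : Set} {P : B → Set} (P? : Decidable P) (f : A → B) →
            ∀ xs → count P? (map f xs) ≡ count (P? ∘ f) xs
count-map P? f []       = refl
count-map P? f (x ∷ xs) with P? (f x)
... | yes _ = cong suc (count-map P? f xs)
... | no  _ = count-map P? f xs

count-any≤sum : {A I : Set} {R : I → A → Set} (R? : ∀ a → Decidable (R a)) →
                ∀ as xs → count (λ x → any? (λ a → R? a x) as) xs ≤ sum (map (λ a → count (R? a) xs) as)
count-any≤sum R? []       xs = ≤-reflexive (count-none (λ x → any? (λ a → R? a x) []) (All.universal (λ _ ()) xs))
count-any≤sum R? (a ∷ as) xs = begin
  count (λ x → any? (λ b → R? b x) (a ∷ as)) xs
    ≤⟨ count-mono (λ x → any? (λ b → R? b x) (a ∷ as)) (λ x → R? a x ⊎-dec any? (λ b → R? b x) as) toSum xs ⟩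
  count (λ x → R? a x ⊎-dec any? (λ b → R? b x) as) xs
    ≤⟨ count-⊎ (R? a) (λ x → any? (λ b → R? b x) as) xs ⟩
  count (R? a) xs + count (λ x → any? (λ b → R? b x) as) xs
    ≤⟨ +-monoʳ-≤ (count (R? a) xs) (count-any≤sum R? as xs) ⟩
  sum (map (λ b → count (R? b) xs) (a ∷ as)) ∎
  where open ≤-Reasoning

sum-map-≤ : {A : Set} (f : A → ℕ) {B : ℕ} → (∀ x → f x ≤ B) → ∀ xs → sum (map f xs) ≤ length xs * B
sum-map-≤ f f≤B []       = z≤n
sum-map-≤ f f≤B (x ∷ xs) = +-mono-≤ (f≤B x) (sum-map-≤ f f≤B xs)

*-sum-map : {A : Set} (c : ℕ) (f : A → ℕ) → ∀ xs → c * sum (map f xs) ≡ sum (map (λ x → c * f x) xs)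
*-sum-map c f []       = *-zeroʳ c
*-sum-map c f (x ∷ xs) = trans (*-distribˡ-+ c (f x) _) (cong (c * f x +_) (*-sum-map c f xs))

module _ {A : Set} {Q : A → Set} (Q? : Decidable Q) (f : A → ℕ) {B : ℕ} where

  sum-map-≤-count* : (∀ {x} → ¬ Q x → f x ≡ 0) → (∀ {x} → Q x → f x ≤ B) →
                     ∀ xs → sum (map f xs) ≤ count Q? xs * B
  sum-map-≤-count* vanish f≤B []       = z≤n
  sum-map-≤-count* vanish f≤B (x ∷ xs) with Q? x
  ... | yes Qx = +-mono-≤ (f≤B Qx) (sum-map-≤-count* vanish f≤B xs)
  ... | no ¬Qx = ≤-trans (≤-reflexive (cong (_+ sum (map f xs)) (vanish ¬Qx)))
                         (sum-map-≤-count* vanish f≤B xs)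

  count*-≤-sum-map : (∀ {x} → Q x → B ≤ f x) → ∀ xs → count Q? xs * B ≤ sum (map f xs)
  count*-≤-sum-map B≤f []       = z≤n
  count*-≤-sum-map B≤f (x ∷ xs) with Q? x
  ... | yes Qx = +-mono-≤ (B≤f Qx) (count*-≤-sum-map B≤f xs)
  ... | no  _  = ≤-trans (count*-≤-sum-map B≤f xs) (m≤n+m _ (f x))

length-≤-Unique-⊆ : {A : Set} {xs ys : List A} → Unique xs → xs ⊆ ys → length xs ≤ length ys
length-≤-Unique-⊆ {xs = []}     _             _      = z≤n
length-≤-Unique-⊆ {xs = x ∷ xs} (x∉xs ∷ xs!) xs⊆ys with ∈-∃++ (xs⊆ys (here refl))
... | as , bs , refl = begin
  suc (length xs)                ≤⟨ s≤s (length-≤-Unique-⊆ xs! xs⊆as++bs) ⟩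
  suc (length (as ++ bs))        ≡⟨ cong suc (length-++ as) ⟩
  suc (length as + length bs)    ≡⟨ +-suc (length as) (length bs) ⟨
  length as + length (x ∷ bs)    ≡⟨ length-++ as ⟨
  length (as ++ [ x ] ++ bs)     ∎
  where
  open ≤-Reasoning
  xs⊆as++bs : xs ⊆ as ++ bs
  xs⊆as++bs y∈xs with ∈-++⁻ as (xs⊆ys (there y∈xs))
  ... | inj₁ y∈as          = ∈-++⁺ˡ y∈as
  ... | inj₂ (here refl)   = contradiction refl (All.lookup x∉xs y∈xs)
  ... | inj₂ (there y∈bs)  = ∈-++⁺ʳ as y∈bs

module _ {m : ℕ} (F : List (Fin m)) where

  open DecMembership (Fin._≟_ {m}) using (_∈?_; _∉?_)

  count-∈-allFin-≤ : count (_∈? F) (allFin m) ≤ length F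
  count-∈-allFin-≤ = length-≤-Unique-⊆ (Unique.filter⁺ (_∈? F) (Unique.allFin⁺ m))
                                       (proj₂ ∘ ∈-filter⁻ (_∈? F) {xs = allFin m})

  count-∉-allFin : Unique F → count (_∉? F) (allFin m) ≡ m ∸ length F
  count-∉-allFin F! = begin
    count (_∉? F) (allFin m)                    ≡⟨ m+n∸m≡n count∈ _ ⟨
    count∈ + count (_∉? F) (allFin m) ∸ count∈  ≡⟨ cong (_∸ count∈) (count-+-count-∁ (_∈? F) (allFin m)) ⟩
    length (allFin m) ∸ count∈                  ≡⟨ cong₂ _∸_ (length-tabulate id) (≤-antisym count-∈-allFin-≤ F≤count∈) ⟩
    m ∸ length F                                ∎
    where
    open ≡-Reasoning
    count∈ : ℕ
    count∈ = count (_∈? F) (allFin m)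
    F≤count∈ : length F ≤ count∈
    F≤count∈ = length-≤-Unique-⊆ F! (λ x∈F → ∈-filter⁺ (_∈? F) (∈-allFin _) x∈F)

count-allStrings : ∀ {m n} {P : Vec (Fin m) (suc n) → Set} (P? : Decidable P) →
                   count P? (allStrings (suc n) m) ≡
                   sum (map (λ x → count (P? ∘ (x ∷_)) (allStrings n m)) (allFin m))
count-allStrings {m} {n} P? = begin
  count P? (concat (map (λ x → map (x ∷_) (allStrings n m)) (allFin m)))
    ≡⟨ count-concat P? (map (λ x → map (x ∷_) (allStrings n m)) (allFin m)) ⟩
  sum (map (count P?) (map (λ x → map (x ∷_) (allStrings n m)) (allFin m)))
    ≡⟨ cong sum (map-∘ (allFin m)) ⟨
  sum (map (λ x → count P? (map (x ∷_) (allStrings n m))) (allFin m))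
    ≡⟨ cong sum (map-cong (λ x → count-map P? (x ∷_) (allStrings n m)) (allFin m)) ⟩
  sum (map (λ x → count (P? ∘ (x ∷_)) (allStrings n m)) (allFin m)) ∎
  where open ≡-Reasoning

count-tabulate-suc : ∀ {n} {Q : Fin (suc n) → Set} (Q? : Decidable Q) →
                     count Q? (tabulate suc) ≡ count (Q? ∘ suc) (allFin n)
count-tabulate-suc {n} Q? = trans (cong (count Q?) (sym (map-tabulate id suc))) (count-map Q? suc (allFin n))

AgreeBelow : {A : Set} {n : ℕ} → Fin n → Vec A n → Vec A n → Set
AgreeBelow i v w = ∀ {j} → toℕ j < toℕ i → lookup v j ≡ lookup w j

record FreeOrForced {m n : ℕ} (P : Vec (Fin m) n → Set) (Free : Fin n → Set) (B : List (Fin m)) : Set where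
  field
    free-injective : ∀ v {i j} → P v → Free i → Free j → lookup v i ≡ lookup v j → i ≡ j
    free-∉         : ∀ v {i} → P v → Free i → lookup v i ∉ B
    forced         : ∀ v w {i} → P v → P w → ¬ Free i → AgreeBelow i v w → lookup v i ≡ lookup w i

module _ {m n : ℕ} {P : Vec (Fin m) (suc n) → Set} {Free : Fin (suc n) → Set} {B : List (Fin m)}
         (shape : FreeOrForced P Free B) where

  open FreeOrForced shape

  FreeOrForced-tail : ∀ x {B′} → (∀ v {i} → P (x ∷ v) → Free (suc i) → lookup v i ∉ B′) →
                      FreeOrForced (λ v → P (x ∷ v)) (Free ∘ suc) B′
  FreeOrForced-tail x tail-∉ = record
    { free-injective = λ v Pv Fi Fj vi≡vj → Fin.suc-injective (free-injective (x ∷ v) Pv Fi Fj vi≡vj)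
    ; free-∉         = tail-∉
    ; forced         = λ v w Pv Pw ¬Fi v≐w →
        forced (x ∷ v) (x ∷ w) Pv Pw ¬Fi (λ { {zero} _ → refl ; {suc j} (s≤s j<i) → v≐w j<i })
    }

module _ {m n : ℕ} {P : Vec (Fin m) (suc n) → Set} (P? : Decidable P)
         {Free : Fin (suc n) → Set} (Free? : Decidable Free) {B : List (Fin m)} (B! : Unique B)
         (shape : FreeOrForced P Free B)
         (count-tail≤ : ∀ {Q : Vec (Fin m) n → Set} (Q? : Decidable Q) {B′} → Unique B′ →
                        FreeOrForced Q (Free ∘ suc) B′ →
                        count Q? (allStrings n m) ≤ fall (m ∸ length B′) (count (Free? ∘ suc) (allFin n)))
         where

  open FreeOrForced shape
  open DecMembership (Fin._≟_ {m}) using (_∈?_; _∉?_)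

  private
    c : ℕ
    c = count (Free? ∘ suc) (allFin n)

    count-head : Fin m → ℕ
    count-head x = count (P? ∘ (x ∷_)) (allStrings n m)

  count-≤-fall-free : Free zero → count P? (allStrings (suc n) m) ≤ fall (m ∸ length B) (suc c)
  count-≤-fall-free free = begin
    count P? (allStrings (suc n) m)                         ≡⟨ count-allStrings P? ⟩
    sum (map count-head (allFin m))                         ≤⟨ sum-map-≤-count* (_∉? B) count-head vanish bound (allFin m) ⟩
    count (_∉? B) (allFin m) * fall (m ∸ suc (length B)) c  ≡⟨ cong (_* fall (m ∸ suc (length B)) c) (count-∉-allFin B B!) ⟩
    (m ∸ length B) * fall (m ∸ suc (length B)) c            ≡⟨ fall-∸-suc m (length B) c ⟩
    fall (m ∸ length B) (suc c)                             ∎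
    where
    open ≤-Reasoning
    vanish : ∀ {x} → ¬ x ∉ B → count-head x ≡ 0
    vanish {x} x∈B = count-none (P? ∘ (x ∷_)) (All.universal (λ v Pv → x∈B (free-∉ (x ∷ v) Pv free)) (allStrings n m))
    bound : ∀ {x} → x ∉ B → count-head x ≤ fall (m ∸ suc (length B)) c
    bound {x} x∉B = count-tail≤ (P? ∘ (x ∷_)) (¬Any⇒All¬ B x∉B ∷ B!) (FreeOrForced-tail shape x λ v Pv Fi → λ
      { (here vi≡x)  → Fin.0≢1+n (free-injective (x ∷ v) Pv free Fi (sym vi≡x))
      ; (there vi∈B) → free-∉ (x ∷ v) Pv Fi vi∈B })

  count-≤-fall-forced : ¬ Free zero → count P? (allStrings (suc n) m) ≤ fall (m ∸ length B) c
  count-≤-fall-forced unfree with any? P? (allStrings (suc n) m)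
  ... | no none = ≤-trans (≤-reflexive (count-none P? (¬Any⇒All¬ _ none))) z≤n
  ... | yes some with satisfied some
  ...   | h ∷ u , Pu = begin
    count P? (allStrings (suc n) m)                      ≡⟨ count-allStrings P? ⟩
    sum (map count-head (allFin m))                      ≤⟨ sum-map-≤-count* (_∈? [ h ]) count-head vanish bound (allFin m) ⟩
    count (_∈? [ h ]) (allFin m) * fall (m ∸ length B) c ≤⟨ *-monoˡ-≤ _ (count-∈-allFin-≤ [ h ]) ⟩
    1 * fall (m ∸ length B) c                            ≡⟨ *-identityˡ _ ⟩
    fall (m ∸ length B) c                                ∎
    where
    open ≤-Reasoning
    vanish : ∀ {x} → ¬ x ∈ [ h ] → count-head x ≡ 0
    vanish {x} x≢h = count-none (P? ∘ (x ∷_))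
      (All.universal (λ v Pv → x≢h (here (forced (x ∷ v) (h ∷ u) Pv Pu unfree λ ()))) (allStrings n m))
    bound : ∀ {x} → x ∈ [ h ] → count-head x ≤ fall (m ∸ length B) c
    bound {x} _ = count-tail≤ (P? ∘ (x ∷_)) B! (FreeOrForced-tail shape x (λ v → free-∉ (x ∷ v)))

count-≤-fall : ∀ {m} n {P : Vec (Fin m) n → Set} (P? : Decidable P) {Free : Fin n → Set} (Free? : Decidable Free)
               {B : List (Fin m)} → Unique B → FreeOrForced P Free B →
               count P? (allStrings n m) ≤ fall (m ∸ length B) (count Free? (allFin n))
count-≤-fall zero    P? Free?     B! shape = length-filter P? ([] ∷ [])
count-≤-fall {m} (suc n) P? Free? {B} B! shape with Free? zero
... | yes free   = ≤-trans (count-≤-fall-free P? Free? B! shape (λ Q? → count-≤-fall n Q? (Free? ∘ suc)) free)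
                           (≤-reflexive (cong (fall (m ∸ length B) ∘ suc) (sym (count-tabulate-suc Free?))))
... | no  unfree = ≤-trans (count-≤-fall-forced P? Free? B! shape (λ Q? → count-≤-fall n Q? (Free? ∘ suc)) unfree)
                           (≤-reflexive (cong (fall (m ∸ length B)) (sym (count-tabulate-suc Free?))))

Fresh : {A : Set} {n : ℕ} → List A → Vec A n → Set
Fresh F []      = ⊤
Fresh F (x ∷ v) = x ∉ F × Fresh (x ∷ F) v

module _ {A : Set} where

  Fresh-∉ : ∀ {n F} {v : Vec A n} → Fresh F v → ∀ i → lookup v i ∉ F
  Fresh-∉ {v = x ∷ v} (x∉F , _)     zero    = x∉F
  Fresh-∉ {v = x ∷ v} (_   , fresh) (suc i) = Fresh-∉ fresh i ∘ there

  Fresh-injective : ∀ {n F} {v : Vec A n} → Fresh F v → ∀ {i j} → lookup v i ≡ lookup v j → i ≡ j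
  Fresh-injective {v = x ∷ v} _             {zero}  {zero}  _  = refl
  Fresh-injective {v = x ∷ v} (_ , fresh)   {zero}  {suc j} eq = contradiction (here (sym eq)) (Fresh-∉ fresh j)
  Fresh-injective {v = x ∷ v} (_ , fresh)   {suc i} {zero}  eq = contradiction (here eq) (Fresh-∉ fresh i)
  Fresh-injective {v = x ∷ v} (_ , fresh)   {suc i} {suc j} eq = cong suc (Fresh-injective fresh eq)

module _ {m : ℕ} where

  open DecMembership (Fin._≟_ {m}) using (_∉?_)

  fresh? : ∀ {n} (F : List (Fin m)) → Decidable (Fresh {n = n} F)
  fresh? F []      = yes tt
  fresh? F (x ∷ v) = (x ∉? F) ×-dec fresh? (x ∷ F) v

  fall-≤-count-fresh : ∀ n (F : List (Fin m)) → Unique F →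
                       fall (m ∸ length F) n ≤ count (fresh? F) (allStrings n m)
  fall-≤-count-fresh zero    F F! = ≤-refl
  fall-≤-count-fresh (suc n) F F! = begin
    fall (m ∸ length F) (suc n)                            ≡⟨ fall-∸-suc m (length F) n ⟨
    (m ∸ length F) * fall (m ∸ suc (length F)) n           ≡⟨ cong (_* fall (m ∸ suc (length F)) n) (count-∉-allFin F F!) ⟨
    count (_∉? F) (allFin m) * fall (m ∸ suc (length F)) n ≤⟨ count*-≤-sum-map (_∉? F) count-head bound (allFin m) ⟩
    sum (map count-head (allFin m))                        ≡⟨ count-allStrings (fresh? F) ⟨
    count (fresh? F) (allStrings (suc n) m)                ∎
    where
    open ≤-Reasoning
    count-head : Fin m → ℕ
    count-head x = count (fresh? F ∘ (x ∷_)) (allStrings n m)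
    bound : ∀ {x} → x ∉ F → fall (m ∸ suc (length F)) n ≤ count-head x
    bound {x} x∉F = ≤-trans (fall-≤-count-fresh n (x ∷ F) (¬Any⇒All¬ F x∉F ∷ F!))
                            (count-mono (fresh? (x ∷ F)) (fresh? F ∘ (x ∷_)) (x∉F ,_) (allStrings n m))

%2≡0⊎%2≡1 : ∀ m → m % 2 ≡ 0 ⊎ m % 2 ≡ 1
%2≡0⊎%2≡1 m with m % 2 | m%n<n m 2
... | 0           | _                 = inj₁ refl
... | 1           | _                 = inj₂ refl
... | suc (suc _) | s≤s (s≤s ())

[b+2r]%2≡b : ∀ {b} r → b < 2 → (b + 2 * r) % 2 ≡ b
[b+2r]%2≡b {b} r b<2 = begin
  (b + 2 * r) % 2 ≡⟨ cong (λ x → (b + x) % 2) (*-comm 2 r) ⟩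
  (b + r * 2) % 2 ≡⟨ [m+kn]%n≡m%n b r 2 ⟩
  b % 2           ≡⟨ m<n⇒m%n≡m b<2 ⟩
  b               ∎
  where open ≡-Reasoning

[b+2r]/2≡r : ∀ {b} r → b < 2 → (b + 2 * r) / 2 ≡ r
[b+2r]/2≡r {b} r b<2 = begin
  (b + 2 * r) / 2     ≡⟨ +-distrib-/-∣ʳ b (m∣m*n r) ⟩
  b / 2 + 2 * r / 2   ≡⟨ cong₂ _+_ (m<n⇒m/n≡0 b<2) (trans (cong (_/ 2) (*-comm 2 r)) (m*n/n≡m r 2)) ⟩
  r                   ∎
  where open ≡-Reasoning

[m%2+[m%2+n%2]%2]%2≡n%2 : ∀ m n → (m % 2 + (m % 2 + n % 2) % 2) % 2 ≡ n % 2
[m%2+[m%2+n%2]%2]%2≡n%2 m n with %2≡0⊎%2≡1 m | %2≡0⊎%2≡1 n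
... | inj₁ m0 | inj₁ n0 rewrite m0 | n0 = refl
... | inj₁ m0 | inj₂ n1 rewrite m0 | n1 = refl
... | inj₂ m1 | inj₁ n0 rewrite m1 | n0 = refl
... | inj₂ m1 | inj₂ n1 rewrite m1 | n1 = refl

xorBits-< : ∀ k m n → xorBits k m n < 2 ^ k
xorBits-< zero    m n = s≤s z≤n
xorBits-< (suc k) m n = begin-strict
  (m % 2 + n % 2) % 2 + 2 * r <⟨ +-monoˡ-< (2 * r) (m%n<n (m % 2 + n % 2) 2) ⟩
  2 + 2 * r                   ≡⟨ *-suc 2 r ⟨
  2 * suc r                   ≤⟨ *-monoʳ-≤ 2 (xorBits-< k (m / 2) (n / 2)) ⟩
  2 * 2 ^ k                   ∎
  where
  open ≤-Reasoning
  r : ℕ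
  r = xorBits k (m / 2) (n / 2)

xorBits-self : ∀ k m → xorBits k m m ≡ 0
xorBits-self zero    m = refl
xorBits-self (suc k) m = cong₂ (λ b r → b + 2 * r) [m%2+m%2]%2≡0 (xorBits-self k (m / 2))
  where
  [m%2+m%2]%2≡0 : (m % 2 + m % 2) % 2 ≡ 0
  [m%2+m%2]%2≡0 = trans (cong (λ x → (m % 2 + x) % 2) (sym (+-identityʳ (m % 2))))
                        (trans (cong (_% 2) (*-comm 2 (m % 2))) (m*n%n≡0 (m % 2) 2))

xorBits-comm : ∀ k m n → xorBits k m n ≡ xorBits k n m
xorBits-comm zero    m n = refl
xorBits-comm (suc k) m n = cong₂ (λ b r → b % 2 + 2 * r) (+-comm (m % 2) (n % 2)) (xorBits-comm k (m / 2) (n / 2))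

xorBits-cancel : ∀ k m n → n < 2 ^ k → xorBits k m (xorBits k m n) ≡ n
xorBits-cancel zero    m zero    _             = refl
xorBits-cancel zero    m (suc n) (s≤s ())
xorBits-cancel (suc k) m n n<2K = begin
  (m % 2 + x % 2) % 2 + 2 * xorBits k (m / 2) (x / 2)
    ≡⟨ cong₂ (λ c y → (m % 2 + c) % 2 + 2 * xorBits k (m / 2) y) ([b+2r]%2≡b r b<2) ([b+2r]/2≡r r b<2) ⟩
  (m % 2 + b) % 2 + 2 * xorBits k (m / 2) r
    ≡⟨ cong₂ (λ c y → c + 2 * y) ([m%2+[m%2+n%2]%2]%2≡n%2 m n) (xorBits-cancel k (m / 2) (n / 2) n/2<K) ⟩
  n % 2 + 2 * (n / 2)
    ≡⟨ trans (cong (n % 2 +_) (*-comm 2 (n / 2))) (sym (m≡m%n+[m/n]*n n 2)) ⟩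
  n ∎
  where
  open ≡-Reasoning
  b : ℕ
  b = (m % 2 + n % 2) % 2
  r : ℕ
  r = xorBits k (m / 2) (n / 2)
  x : ℕ
  x = b + 2 * r
  b<2 : b < 2
  b<2 = m%n<n (m % 2 + n % 2) 2
  n/2<K : n / 2 < 2 ^ k
  n/2<K = m<n*o⇒m/o<n (subst (n <_) (*-comm 2 (2 ^ k)) n<2K)

module _ {A : Set} where

  assignedValues : ∀ {n} → Vec (Maybe A) n → List A
  assignedValues = catMaybes ∘ toList

  length-assignedValues : ∀ {n} (ζ : Vec (Maybe A) n) → length (assignedValues ζ) ≡ supportSize ζ
  length-assignedValues []            = refl
  length-assignedValues (nothing ∷ ζ) = length-assignedValues ζ
  length-assignedValues (just _ ∷ ζ)  = cong suc (length-assignedValues ζ)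

  ∈-assignedValues⁻ : ∀ {n} (ζ : Vec (Maybe A) n) {t} → t ∈ assignedValues ζ → ∃[ i ] lookup ζ i ≡ just t
  ∈-assignedValues⁻ (nothing ∷ ζ) t∈ with ∈-assignedValues⁻ ζ t∈
  ... | i , ζi≡t = suc i , ζi≡t
  ∈-assignedValues⁻ (just _ ∷ ζ) (here refl) = zero , refl
  ∈-assignedValues⁻ (just _ ∷ ζ) (there t∈) with ∈-assignedValues⁻ ζ t∈
  ... | i , ζi≡t = suc i , ζi≡t

  assignedValues-unique : ∀ {n} (ζ : Vec (Maybe A) n) {v : Vec A n} →
                          (∀ {i j} → lookup v i ≡ lookup v j → i ≡ j) →
                          (∀ {i t} → lookup ζ i ≡ just t → lookup v i ≡ t) →
                          Unique (assignedValues ζ)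
  assignedValues-unique []            {[]}    _         _    = []
  assignedValues-unique (nothing ∷ ζ) {_ ∷ v} injective fits =
    assignedValues-unique ζ {v} (λ eq → Fin.suc-injective (injective eq)) (λ {i} → fits {suc i})
  assignedValues-unique (just t ∷ ζ)  {x ∷ v} injective fits =
    All.tabulate t∉ ∷ assignedValues-unique ζ {v} (λ eq → Fin.suc-injective (injective eq)) (λ {i} → fits {suc i})
    where
    t∉ : ∀ {u} → u ∈ assignedValues ζ → t ≢ u
    t∉ u∈ refl with ∈-assignedValues⁻ ζ u∈
    ... | i , ζi≡t = Fin.0≢1+n (injective {zero} {suc i} (trans (fits {zero} refl) (sym (fits {suc i} ζi≡t))))

module _ (k : ℕ) where

  module _ (a : Sym k) where

    partner : Sym k → Sym k
    partner i = fromℕ< (xorBits-< k (toℕ i) (toℕ a))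

    xor-partner : ∀ i → xor k i (partner i) ≡ toℕ a
    xor-partner i = trans (cong (xorBits k (toℕ i)) (Fin.toℕ-fromℕ< _)) (xorBits-cancel k (toℕ i) (toℕ a) (Fin.toℕ<n a))

    partner-unique : ∀ {i j} → xor k i j ≡ toℕ a → j ≡ partner i
    partner-unique {i} {j} i⊕j≡a = Fin.toℕ-injective (begin
      toℕ j                          ≡⟨ xorBits-cancel k (toℕ i) (toℕ j) (Fin.toℕ<n j) ⟨
      xorBits k (toℕ i) (xor k i j)  ≡⟨ cong (xorBits k (toℕ i)) i⊕j≡a ⟩
      xorBits k (toℕ i) (toℕ a)      ≡⟨ Fin.toℕ-fromℕ< _ ⟨
      toℕ (partner i)                ∎)
      where open ≡-Reasoning

    partner-involutive : ∀ i → partner (partner i) ≡ i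
    partner-involutive i = sym (partner-unique (trans (xorBits-comm k (toℕ (partner i)) (toℕ i)) (xor-partner i)))

    partner-injective : ∀ {i j} → partner i ≡ partner j → i ≡ j
    partner-injective {i} {j} eq = trans (sym (partner-involutive i)) (trans (cong partner eq) (partner-involutive j))

    partner-self : toℕ a ≡ 0 → ∀ i → partner i ≡ i
    partner-self a≡0 i = sym (partner-unique (trans (xorBits-self k (toℕ i)) (sym a≡0)))

    partner-≢ : toℕ a ≢ 0 → ∀ i → partner i ≢ i
    partner-≢ a≢0 i pi≡i = a≢0 (trans (sym (xor-partner i)) (trans (cong (xor k i) pi≡i) (xorBits-self k (toℕ i))))

    Low : Sym k → Set
    Low i = toℕ i < toℕ (partner i)

    low? : Decidable Low
    low? i = toℕ i <? toℕ (partner i)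

    2*count-low≤K : 2 * count low? (allFin (Kof k)) ≤ Kof k
    2*count-low≤K = begin
      2 * count low? (allFin K)                            ≡⟨ cong (count low? (allFin K) +_) (+-identityʳ _) ⟩
      count low? (allFin K) + count low? (allFin K)        ≤⟨ +-monoʳ-≤ _ count-low≤count-high ⟩
      count low? (allFin K) + count (∁? low?) (allFin K)   ≡⟨ count-+-count-∁ low? (allFin K) ⟩
      length (allFin K)                                    ≡⟨ length-tabulate id ⟩
      K                                                    ∎
      where
      open ≤-Reasoning
      K : ℕ
      K = Kof k
      partner-low-high : map partner (filter low? (allFin K)) ⊆ filter (∁? low?) (allFin K)
      partner-low-high p∈ with ∈-map⁻ partner p∈
      ... | i , i∈ , refl = ∈-filter⁺ (∁? low?) (∈-allFin (partner i))
        (λ low-pi → <-asym (proj₂ (∈-filter⁻ low? {xs = allFin K} i∈))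
                           (subst (λ j → toℕ (partner i) < toℕ j) (partner-involutive i) low-pi))
      count-low≤count-high : count low? (allFin K) ≤ count (∁? low?) (allFin K)
      count-low≤count-high = begin
        count low? (allFin K)
          ≡⟨ length-map partner (filter low? (allFin K)) ⟨
        length (map partner (filter low? (allFin K)))
          ≤⟨ length-≤-Unique-⊆ (Unique.map⁺ partner-injective (Unique.filter⁺ low? (Unique.allFin⁺ K))) partner-low-high ⟩
        count (∁? low?) (allFin K) ∎

  module _ (y : Input k) {a : Sym k} (simon : IsSimon k y a) where

    simon-collision : ∀ {i j} → i ≢ j → lookup y i ≡ lookup y j → j ≡ partner a i
    simon-collision i≢j yi≡yj = partner-unique a (proj₁ (simon _ _ i≢j) yi≡yj)

    simon-partner : toℕ a ≢ 0 → ∀ i → lookup y i ≡ lookup y (partner a i)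
    simon-partner a≢0 i = proj₂ (simon i (partner a i) (partner-≢ a a≢0 i ∘ sym)) (xor-partner a i)

    simon-injective : toℕ a ≡ 0 → ∀ {i j} → lookup y i ≡ lookup y j → i ≡ j
    simon-injective a≡0 {i} {j} yi≡yj with i Fin.≟ j
    ... | yes i≡j = i≡j
    ... | no  i≢j = sym (trans (simon-collision i≢j yi≡yj) (partner-self a a≡0 i))

  injective-simon : ∀ (y : Input k) → (∀ {i j} → lookup y i ≡ lookup y j → i ≡ j) →
                    ∀ {a} → toℕ a ≡ 0 → IsSimon k y a
  injective-simon y injective {a} a≡0 i j i≢j =
    (λ yi≡yj → contradiction (injective yi≡yj) i≢j) ,
    (λ i⊕j≡a → contradiction (sym (trans (partner-unique a i⊕j≡a) (partner-self a a≡0 i))) i≢j)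

  !≤numLegal : Kof k ! ≤ numLegal k
  !≤numLegal = begin
    Kof k !                           ≡⟨ fall-diag (Kof k) ⟨
    fall (Kof k) (Kof k)              ≤⟨ fall-≤-count-fresh (Kof k) [] [] ⟩
    count (fresh? []) (allInputs k)   ≤⟨ count-mono (fresh? []) (legal? k) fresh-legal (allInputs k) ⟩
    numLegal k                        ∎
    where
    open ≤-Reasoning
    0<K : 0 < Kof k
    0<K = m^n>0 2 k
    fresh-legal : ∀ {y} → Fresh [] y → Legal k y
    fresh-legal {y} fresh = fromℕ< 0<K , injective-simon y (Fresh-injective fresh) (Fin.toℕ-fromℕ< 0<K)

  module _ (ζ : PartialAssignment k) where

    SimonExt : Sym k → Input k → Set
    SimonExt a y = IsSimon k y a × Extends k y ζ

    simonExt? : ∀ a → Decidable (SimonExt a)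
    simonExt? a y = isSimon? k y a ×-dec extends? k y ζ

    simonExtCount : Sym k → ℕ
    simonExtCount a = count (simonExt? a) (allInputs k)

    numLegalExt≤sum : numLegalExt k ζ ≤ sum (map simonExtCount (allFin (Kof k)))
    numLegalExt≤sum = ≤-trans
      (count-mono (legalExt? k ζ) (λ y → any? (λ a → simonExt? a y) (allFin (Kof k)))
                  (λ ((a , simon) , ext) → lose (∈-allFin a) (simon , ext)) (allInputs k))
      (count-any≤sum simonExt? (allFin (Kof k)) (allInputs k))

    extends-just : ∀ y {i t} → Extends k y ζ → lookup ζ i ≡ just t → lookup y i ≡ t
    extends-just y {i} ext ζi≡t = subst (λ m → Agrees k m (lookup y i)) ζi≡t (ext i)

    Unassigned : Sym k → Set
    Unassigned i = lookup ζ i ≡ nothing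

    unassigned? : Decidable Unassigned
    unassigned? i = Maybe.≡-dec Fin._≟_ (lookup ζ i) nothing

    module _ {a : Sym k} (a≡0 : toℕ a ≡ 0) where

      simonExt-FreeOrForced : FreeOrForced (SimonExt a) Unassigned (assignedValues ζ)
      simonExt-FreeOrForced = record
        { free-injective = λ v (simon , _) _ _ → simon-injective v simon a≡0
        ; free-∉         = unassigned-∉
        ; forced         = assigned-forced
        }
        where
        unassigned-∉ : ∀ y {i} → SimonExt a y → Unassigned i → lookup y i ∉ assignedValues ζ
        unassigned-∉ y {i} (simon , ext) ζi≡nothing yi∈ with ∈-assignedValues⁻ ζ yi∈
        ... | j , ζj≡yi with simon-injective y simon a≡0 {j} {i} (extends-just y ext ζj≡yi)
        ...   | refl = contradiction (trans (sym ζi≡nothing) ζj≡yi) λ ()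
        assigned-forced : ∀ v w {i} → SimonExt a v → SimonExt a w → ¬ Unassigned i → AgreeBelow i v w →
                          lookup v i ≡ lookup w i
        assigned-forced v w {i} (_ , ext-v) (_ , ext-w) assigned _ with lookup ζ i in ζi
        ... | nothing = contradiction refl assigned
        ... | just t  = trans (extends-just v ext-v ζi) (sym (extends-just w ext-w ζi))

      simonExtCount-zero≤ : simonExtCount a ≤ (Kof k ∸ supportSize ζ) !
      simonExtCount-zero≤ with unique? Fin._≟_ (assignedValues ζ)
      ... | yes B! = begin
        simonExtCount a
          ≤⟨ count-≤-fall (Kof k) (simonExt? a) unassigned? B! simonExt-FreeOrForced ⟩
        fall (Kof k ∸ length (assignedValues ζ)) (count unassigned? (allFin (Kof k)))
          ≤⟨ fall≤! (Kof k ∸ length (assignedValues ζ)) (count unassigned? (allFin (Kof k))) ⟩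
        (Kof k ∸ length (assignedValues ζ)) !
          ≡⟨ cong (λ s → (Kof k ∸ s) !) (length-assignedValues ζ) ⟩
        (Kof k ∸ supportSize ζ) ! ∎
        where open ≤-Reasoning
      ... | no ¬B! = ≤-trans (≤-reflexive (count-none (simonExt? a) (All.universal no-extension (allInputs k)))) z≤n
        where
        no-extension : ∀ y → ¬ SimonExt a y
        no-extension y (simon , ext) = ¬B! (assignedValues-unique ζ {y} (simon-injective y simon a≡0) (extends-just y ext))

  module _ {a : Sym k} (a≢0 : toℕ a ≢ 0) where

    simon-FreeOrForced : FreeOrForced (λ y → IsSimon k y a) (Low a) []
    simon-FreeOrForced = record
      { free-injective = low-injective
      ; free-∉         = λ _ _ _ ()
      ; forced         = high-forced
      }
      where
      low-injective : ∀ y {i j} → IsSimon k y a → Low a i → Low a j → lookup y i ≡ lookup y j → i ≡ j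
      low-injective y {i} {j} simon low-i low-j yi≡yj with i Fin.≟ j
      ... | yes i≡j = i≡j
      ... | no  i≢j with simon-collision y simon i≢j yi≡yj
      ...   | refl = contradiction (subst (λ l → toℕ (partner a i) < toℕ l) (partner-involutive a i) low-j) (<-asym low-i)
      high-forced : ∀ v w {i} → IsSimon k v a → IsSimon k w a → ¬ Low a i → AgreeBelow i v w → lookup v i ≡ lookup w i
      high-forced v w {i} simon-v simon-w high v≐w = begin
        lookup v i             ≡⟨ simon-partner v simon-v a≢0 i ⟩
        lookup v (partner a i) ≡⟨ v≐w partner<i ⟩
        lookup w (partner a i) ≡⟨ simon-partner w simon-w a≢0 i ⟨
        lookup w i             ∎
        where
        open ≡-Reasoning
        partner<i : toℕ (partner a i) < toℕ i
        partner<i = ≤∧≢⇒< (≮⇒≥ high) (partner-≢ a a≢0 i ∘ Fin.toℕ-injective)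

    simonExtCount-nonzero≤ : ∀ ζ → simonExtCount ζ a ≤ fall (Kof k) (count (low? a) (allFin (Kof k)))
    simonExtCount-nonzero≤ ζ = ≤-trans
      (count-mono (simonExt? ζ a) (λ y → isSimon? k y a) proj₁ (allInputs k))
      (count-≤-fall (Kof k) (λ y → isSimon? k y a) (low? a) [] simon-FreeOrForced)

  module _ (ζ : PartialAssignment k) (s²≤K : supportSize ζ * supportSize ζ ≤ Kof k) where

    private
      K : ℕ
      K = Kof k
      s : ℕ
      s = supportSize ζ
      instance
        K≢0 : NonZero K
        K≢0 = m^n≢0 2 k

    Kˢ*simonExtCount-zero≤ : ∀ {a} → toℕ a ≡ 0 → K ^ s * simonExtCount ζ a ≤ 2 * K !
    Kˢ*simonExtCount-zero≤ {a} a≡0 = begin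
      K ^ s * simonExtCount ζ a   ≤⟨ *-monoʳ-≤ (K ^ s) (simonExtCount-zero≤ ζ a≡0) ⟩
      K ^ s * (K ∸ s) !           ≤⟨ *-monoˡ-≤ ((K ∸ s) !) (pow≤2*fall {K} {s} s²≤K) ⟩
      2 * fall K s * (K ∸ s) !    ≡⟨ *-assoc 2 (fall K s) ((K ∸ s) !) ⟩
      2 * (fall K s * (K ∸ s) !)  ≤⟨ *-monoʳ-≤ 2 (fall*!≤! K s) ⟩
      2 * K !                     ∎
      where open ≤-Reasoning

    Kˢ*simonExtCount-nonzero≤ : ∀ {a} → toℕ a ≢ 0 → K ^ s * simonExtCount ζ a ≤ K ^ 6 * K !
    Kˢ*simonExtCount-nonzero≤ {a} a≢0 = begin
      K ^ s * simonExtCount ζ a         ≤⟨ *-monoʳ-≤ (K ^ s) (simonExtCount-nonzero≤ a≢0 ζ) ⟩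
      K ^ s * fall K L                  ≤⟨ *-monoˡ-≤ (fall K L) (pow≤pow⁶*[K∸L]! k {s} {L} s²≤K (2*count-low≤K a)) ⟩
      K ^ 6 * (K ∸ L) ! * fall K L      ≡⟨ trans (*-assoc (K ^ 6) _ _) (cong (K ^ 6 *_) (*-comm ((K ∸ L) !) _)) ⟩
      K ^ 6 * (fall K L * (K ∸ L) !)    ≤⟨ *-monoʳ-≤ (K ^ 6) (fall*!≤! K L) ⟩
      K ^ 6 * K !                       ∎
      where
      open ≤-Reasoning
      L : ℕ
      L = count (low? a) (allFin K)

    Kˢ*simonExtCount≤ : ∀ a → K ^ s * simonExtCount ζ a ≤ 2 * (K ^ 6 * K !)
    Kˢ*simonExtCount≤ a with toℕ a ≟ 0
    ... | yes a≡0 = ≤-trans (Kˢ*simonExtCount-zero≤ a≡0) (*-monoʳ-≤ 2 (m≤n*m (K !) (K ^ 6) {{m^n≢0 K 6}}))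
    ... | no  a≢0 = ≤-trans (Kˢ*simonExtCount-nonzero≤ a≢0) (m≤n*m (K ^ 6 * K !) 2)

    Kˢ*numLegalExt≤ : K ^ s * numLegalExt k ζ ≤ 2 * K ^ 7 * numLegal k
    Kˢ*numLegalExt≤ = begin
      K ^ s * numLegalExt k ζ                                ≤⟨ *-monoʳ-≤ (K ^ s) (numLegalExt≤sum ζ) ⟩
      K ^ s * sum (map (simonExtCount ζ) (allFin K))         ≡⟨ *-sum-map (K ^ s) (simonExtCount ζ) (allFin K) ⟩
      sum (map (λ a → K ^ s * simonExtCount ζ a) (allFin K)) ≤⟨ sum-map-≤ _ Kˢ*simonExtCount≤ (allFin K) ⟩
      length (allFin K) * (2 * (K ^ 6 * K !))                ≡⟨ cong (_* (2 * (K ^ 6 * K !))) (length-tabulate {n = K} id) ⟩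
      K * (2 * (K ^ 6 * K !))                                ≡⟨ regroup K (K ^ 6) (K !) ⟩
      2 * K ^ 7 * K !                                        ≤⟨ *-monoʳ-≤ (2 * K ^ 7) !≤numLegal ⟩
      2 * K ^ 7 * numLegal k                                 ∎
      where
      open ≤-Reasoning
      regroup : ∀ K X F → K * (2 * (X * F)) ≡ 2 * (K * X) * F
      regroup = solve-∀

-- The bound holds for every ζ with |I|² ≤ K, certificate or not: the last hypothesis is unused.
lemma6 : ∃[ C ] ∃[ c ] ∀ (k : ℕ) (ζ : PartialAssignment k) →
    supportSize ζ * supportSize ζ ≤ Kof k →
    ¬ IsCertificate k ζ →
    Kof k ^ supportSize ζ * numLegalExt k ζ ≤ C * Kof k ^ c * numLegal k
lemma6 = 2 , 7 , λ k ζ s²≤K _ → Kˢ*numLegalExt≤ k ζ s²≤K
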